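{- For every positive integer $n$, $\operatorname{ord}_{s_{123,132}}(S_n)\le 2\left\lfloor\frac{n-1}{2}\right\rfloor$.
   Context: $S_n$ is the set of permutations of $\{1,\dots,n\}$ in one-line notation. A sequence of distinct integers contains a pattern $\tau\in S_m$ if it has a subsequence in the same relative order as $\tau$; otherwise it avoids $\tau$. The map $s_{123,132}:S_n\to S_n$: read the entries of $\pi$ left to right using one stack (initially empty); at each step, if there is a remaining input entry $x$ and placing $x$ on top of the stack gives a stack whose contents read from top to bottom avoid both $123$ and $132$, push $x$ (pushing has priority); otherwise pop the top of the stack to the output. When the input is exhausted, pop the remaining stack entries from the top to the output. A permutation $\pi$ is periodic under $s_{123,132}$ if $s_{123,132}^k(\pi)=\pi$ for some positive integer $k$. For a set $P$ of permutations, $\operatorname{ord}_{s_{123,132}}(P)$ is the smallest nonnegative integer $k$ such that every element of $s_{123,132}^k(P)$ is periodic under $s_{123,132}$. -}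

module Defs where

open import Data.Nat using (ℕ; zero; suc; _+_; _*_; _<ᵇ_; _≤_)
open import Data.Bool using (Bool; true; false; if_then_else_; _∧_; not)
open import Data.Bool.Properties using () renaming (_≟_ to _≟ᵇ_)
open import Data.List using (List; []; _∷_; _++_; [_]; map; upTo; length; zip)
open import Data.Bool.ListAction using (any; all)
open import Data.List.Relation.Binary.Permutation.Propositional using (_↭_)
open import Data.Product using (Σ; _×_; _,_; ∃-syntax)
open import Relation.Binary.PropositionalEquality using (_≡_)
open import Relation.Nullary.Decidable using (⌊_⌋)
open import Function using (_∘_)

-- Permutations in one-line notation: S_n = lists that are rearrangements of [1, …, n].
oneToN : ℕ → List ℕ
oneToN n = map suc (upTo n)

InS : ℕ → List ℕ → Set
InS n π = π ↭ oneToN n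

subseqs : List ℕ → List (List ℕ)
subseqs [] = [] ∷ []
subseqs (x ∷ xs) = map (x ∷_) (subseqs xs) ++ subseqs xs

_==ᵇ_ : Bool → Bool → Bool
a ==ᵇ b = ⌊ a ≟ᵇ b ⌋

sameOrder : List ℕ → List ℕ → Bool
sameOrder [] [] = true
sameOrder (a ∷ as) (b ∷ bs) =
  all (λ p → (a <ᵇ Data.Product.proj₁ p) ==ᵇ (b <ᵇ Data.Product.proj₂ p)) (zip as bs)
  ∧ sameOrder as bs
sameOrder _ _ = false

contains : List ℕ → List ℕ → Bool
contains σ τ = any (λ s → sameOrder s τ) (subseqs σ)

avoids : List ℕ → List ℕ → Bool
avoids σ τ = not (contains σ τ)

-- The stack contents (listed top to bottom) avoid both 123 and 132.
okStack : List ℕ → Bool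
okStack st = avoids st (1 ∷ 2 ∷ 3 ∷ []) ∧ avoids st (1 ∷ 3 ∷ 2 ∷ [])

-- Arguments: fuel, remaining input, stack (head = top), output so far.
run : ℕ → List ℕ → List ℕ → List ℕ → List ℕ
run zero inp st out = out ++ st
run (suc f) [] st out = out ++ st
run (suc f) (x ∷ xs) st out with okStack (x ∷ st)
... | true = run f xs (x ∷ st) out
... | false with st
...   | [] = run f xs (x ∷ []) out
...   | (y ∷ ys) = run f (x ∷ xs) ys (out ++ [ y ])

-- The map s_{123,132}.  Each step pushes or pops an entry, so 2·|π| steps suffice
-- for the run to consume all input.
s123,132 : List ℕ → List ℕ
s123,132 π = run (2 * length π) π [] []

iterate : ℕ → (List ℕ → List ℕ) → List ℕ → List ℕ
iterate zero f x = x
iterate (suc k) f x = f (iterate k f x)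

Periodic : List ℕ → Set
Periodic π = Σ ℕ λ k → (1 ≤ k) × (iterate k s123,132 π ≡ π)

-- ord_{s}(S_n) ≤ m : the least k such that every element of s^k(S_n) is periodic is at most m,
-- i.e. some k ≤ m has this property.
OrdSnAtMost : ℕ → ℕ → Set
OrdSnAtMost n m = ∃[ k ] (k ≤ m) × (∀ π → InS n π → Periodic (iterate k s123,132 π))

{-# OPTIONS --safe #-}
module Submission where

open import Defs
open import Data.Nat using (ℕ; _≤_; _*_; _∸_; _/_)
open import Data.Nat using (zero; suc; _+_; _<_; _<ᵇ_; _≤ᵇ_; z≤n; s≤s)
open import Data.Nat.Properties
open import Data.Nat.DivMod using (m≡m%n+[m/n]*n; m/n*n≤m; m%n<n)
open import Data.Nat.Tactic.RingSolver using (solve-∀)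
open import Data.Bool using (Bool; true; false; _∧_; _∨_; not; if_then_else_)
open import Data.Bool.Properties using (∨-identityʳ; ∨-assoc; ¬-not; not-involutive; ∧-zeroʳ; ∨-commutativeMonoid; T-≡)
open import Data.Bool.ListAction using (any)
open import Algebra.Bundles using (CommutativeMonoid)
open import Algebra.Properties.CommutativeSemigroup (CommutativeMonoid.commutativeSemigroup ∨-commutativeMonoid) using () renaming (interchange to ∨-interchange)
open import Data.List using (List; []; _∷_; _++_; [_]; map; length; take; drop; upTo)
open import Data.List.Properties using (++-assoc; ++-identityʳ; length-++; ∷-injectiveʳ; ∷ʳ-injective; ∷ʳ-injectiveˡ; take-all; length-map; length-upTo)
open import Data.List.Relation.Unary.All using (All; []; _∷_)
import Data.List.Relation.Unary.All as All
open import Data.List.Relation.Unary.All.Properties using () renaming (++⁻ˡ to All-++⁻ˡ; ++⁻ʳ to All-++⁻ʳ; ++⁺ to All-++⁺)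
open import Data.List.Relation.Unary.Any using (here; there)
open import Data.List.Relation.Unary.Unique.Propositional using (Unique; []; _∷_)
open import Data.List.Relation.Unary.Unique.Propositional.Properties using (Unique[x∷xs]⇒x∉xs; map⁺; upTo⁺)
open import Data.List.Membership.Propositional using (_∈_; _∉_)
open import Data.List.Membership.Propositional.Properties using (∈-++⁺ˡ; ∈-++⁺ʳ; ∈-++⁻; ∈-∃++; ∈-map⁺; ∈-map⁻; ∈-upTo⁺)
open import Data.List.Relation.Binary.Permutation.Propositional using (_↭_; refl; prep; swap; ↭-reflexive; ↭-sym; ↭⇒↭ₛ; module PermutationReasoning)
open import Data.List.Relation.Binary.Permutation.Propositional.Properties using (↭-length; All-resp-↭; ∈-resp-↭; ++⁺ˡ; ++⁺ʳ; ++-comm; shift)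
import Data.List.Relation.Binary.Permutation.Setoid.Properties as Permutationₛ
open import Data.Product using (_×_; _,_; proj₁; proj₂; ∃; ∃₂)
open import Data.Sum using (_⊎_; inj₁; inj₂)
open import Data.Empty using (⊥; ⊥-elim)
open import Function using (_∘_; case_of_)
open import Function.Bundles using (Equivalence)
open import Relation.Nullary using (contradiction)
open import Relation.Binary.PropositionalEquality hiding ([_])

-- A stack avoiding 123 and 132 still does after pushing x iff at most one of its entries
-- exceeds x, so s is the function stackSort below.  Let m = ⌊(n − 1)/2⌋ and
-- zigzag (c₁ … c_k) = k c₁ (k−1) c₂ … 1 c_k.  By induction on k ≤ m, s^{2k}(π) = α ++ zigzag q
-- where α ++ q lists {k+1, …, n}, |α| = n − 2k, and each k + r ≤ m with r ≤ k lies among the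
-- last 2r entries of α or the first r entries of q.  If α starts with h and s(α) = P ++ [h]
-- (h never leaves the bottom of the stack), then s(α ++ zigzag q) = P ++ zigzagTail (q ++ [h]):
-- the first label empties the stack down to h and the zigzag shifts by one place.  The Tail
-- Lemma (if every entry of α below x is among its last M, then x is among the last M + 2 of
-- s(α)) preserves the invariant and, after the odd application, makes k + 1 the second-to-last
-- entry of s(α), so the even application turns it into the new label.  After m rounds
-- |α| ∈ {1, 2}, and s acts on α ++ zigzag q by rotating α ++ q, so the state is periodic.

countGreater : ℕ → List ℕ → ℕ
countGreater x [] = 0
countGreater x (y ∷ ys) = if x <ᵇ y then suc (countGreater x ys) else countGreater x ys

canPush : ℕ → List ℕ → Bool
canPush x st = countGreater x st ≤ᵇ 1

-- Stacks are listed top first.  Reading x, the entries popped x st are output and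
-- kept x st stays below x.
popped : ℕ → List ℕ → List ℕ
popped x [] = []
popped x (y ∷ ys) = if canPush x (y ∷ ys) then [] else y ∷ popped x ys

kept : ℕ → List ℕ → List ℕ
kept x [] = []
kept x (y ∷ ys) = if canPush x (y ∷ ys) then y ∷ ys else kept x ys

emitted : List ℕ → List ℕ → List ℕ
emitted [] st = []
emitted (x ∷ xs) st = popped x st ++ emitted xs (x ∷ kept x st)

stackAfter : List ℕ → List ℕ → List ℕ
stackAfter [] st = st
stackAfter (x ∷ xs) st = stackAfter xs (x ∷ kept x st)

machine : List ℕ → List ℕ → List ℕ
machine inp st = emitted inp st ++ stackAfter inp st

stackSort : List ℕ → List ℕ
stackSort π = machine π []

machine-∷ : ∀ x xs st → machine (x ∷ xs) st ≡ popped x st ++ machine xs (x ∷ kept x st)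
machine-∷ x xs st = ++-assoc (popped x st) _ _

canPush⇒no-pops : ∀ {x} st → canPush x st ≡ true → popped x st ≡ [] × kept x st ≡ st
canPush⇒no-pops [] _ = refl , refl
canPush⇒no-pops (y ∷ ys) push rewrite push = refl , refl

machine-push : ∀ {x} xs st → canPush x st ≡ true → machine (x ∷ xs) st ≡ machine xs (x ∷ st)
machine-push {x} xs st push with canPush⇒no-pops st push
... | popped≡[] , kept≡st = trans (machine-∷ x xs st) (cong₂ (λ o k → o ++ machine xs (x ∷ k)) popped≡[] kept≡st)

machine-pop : ∀ {x} xs y ys → canPush x (y ∷ ys) ≡ false → machine (x ∷ xs) (y ∷ ys) ≡ y ∷ machine (x ∷ xs) ys
machine-pop {x} xs y ys pop rewrite machine-∷ x xs (y ∷ ys) | pop = cong (y ∷_) (sym (machine-∷ x xs ys))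

-- Avoiding 123 and 132 on the stack

anyPair : (ℕ → ℕ → Bool) → List ℕ → Bool
anyPair h [] = false
anyPair h (a ∷ as) = any (h a) as ∨ anyPair h as

module _ {A : Set} where

  any-++ : ∀ (p : A → Bool) xs ys → any p (xs ++ ys) ≡ any p xs ∨ any p ys
  any-++ p [] ys = refl
  any-++ p (x ∷ xs) ys = trans (cong (p x ∨_) (any-++ p xs ys)) (sym (∨-assoc (p x) _ _))

  any-map : ∀ {B : Set} (p : B → Bool) (f : A → B) xs → any p (map f xs) ≡ any (p ∘ f) xs
  any-map p f [] = refl
  any-map p f (x ∷ xs) = cong (p (f x) ∨_) (any-map p f xs)

  any-false : ∀ (p : A → Bool) xs → (∀ z → p z ≡ false) → any p xs ≡ false
  any-false p [] _ = refl
  any-false p (x ∷ xs) never rewrite never x = any-false p xs never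

  any-cong : ∀ {p q : A → Bool} xs → (∀ z → p z ≡ q z) → any p xs ≡ any q xs
  any-cong [] _ = refl
  any-cong (x ∷ xs) p≗q = cong₂ _∨_ (p≗q x) (any-cong xs p≗q)

  any-∨ : ∀ (p q : A → Bool) xs → any p xs ∨ any q xs ≡ any (λ z → p z ∨ q z) xs
  any-∨ p q [] = refl
  any-∨ p q (x ∷ xs) = trans (∨-interchange (p x) (any p xs) (q x) (any q xs)) (cong ((p x ∨ q x) ∨_) (any-∨ p q xs))

any-subseqs-∷ : ∀ (h : List ℕ → Bool) x xs →
  any h (subseqs (x ∷ xs)) ≡ any (h ∘ (x ∷_)) (subseqs xs) ∨ any h (subseqs xs)
any-subseqs-∷ h x xs =
  trans (any-++ h (map (x ∷_) (subseqs xs)) (subseqs xs)) (cong (_∨ any h (subseqs xs)) (any-map h (x ∷_) (subseqs xs)))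

OnlyTrueAtLength : ℕ → (List ℕ → Bool) → Set
OnlyTrueAtLength k h = ∀ s → h s ≡ true → length s ≡ k

false-off-length : ∀ {k h} → OnlyTrueAtLength k h → ∀ s → length s ≢ k → h s ≡ false
false-off-length only s ≢k = ¬-not (≢k ∘ only s)

any-subseqs-length0 : ∀ h xs → OnlyTrueAtLength 0 h → any h (subseqs xs) ≡ h []
any-subseqs-length0 h [] _ = ∨-identityʳ (h [])
any-subseqs-length0 h (x ∷ xs) only = begin
  any h (subseqs (x ∷ xs))
    ≡⟨ any-subseqs-∷ h x xs ⟩
  any (h ∘ (x ∷_)) (subseqs xs) ∨ any h (subseqs xs)
    ≡⟨ cong (_∨ _) (any-false _ (subseqs xs) (λ s → false-off-length only (x ∷ s) λ ())) ⟩
  any h (subseqs xs)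
    ≡⟨ any-subseqs-length0 h xs only ⟩
  h [] ∎
  where open ≡-Reasoning

any-subseqs-length1 : ∀ h xs → OnlyTrueAtLength 1 h → any h (subseqs xs) ≡ any (h ∘ [_]) xs
any-subseqs-length1 h [] only = trans (∨-identityʳ (h [])) (false-off-length only [] λ ())
any-subseqs-length1 h (x ∷ xs) only = begin
  any h (subseqs (x ∷ xs))
    ≡⟨ any-subseqs-∷ h x xs ⟩
  any (h ∘ (x ∷_)) (subseqs xs) ∨ any h (subseqs xs)
    ≡⟨ cong₂ _∨_ (any-subseqs-length0 _ xs (λ s → suc-injective ∘ only (x ∷ s))) (any-subseqs-length1 h xs only) ⟩
  h [ x ] ∨ any (h ∘ [_]) xs ∎
  where open ≡-Reasoning

any-subseqs-length2 : ∀ h xs → OnlyTrueAtLength 2 h → any h (subseqs xs) ≡ anyPair (λ a b → h (a ∷ b ∷ [])) xs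
any-subseqs-length2 h [] only = trans (∨-identityʳ (h [])) (false-off-length only [] λ ())
any-subseqs-length2 h (x ∷ xs) only = begin
  any h (subseqs (x ∷ xs))
    ≡⟨ any-subseqs-∷ h x xs ⟩
  any (h ∘ (x ∷_)) (subseqs xs) ∨ any h (subseqs xs)
    ≡⟨ cong₂ _∨_ (any-subseqs-length1 _ xs (λ s → suc-injective ∘ only (x ∷ s))) (any-subseqs-length2 h xs only) ⟩
  anyPair (λ a b → h (a ∷ b ∷ [])) (x ∷ xs) ∎
  where open ≡-Reasoning

sameOrder-length : ∀ as bs → sameOrder as bs ≡ true → length as ≡ length bs
sameOrder-length [] [] _ = refl
sameOrder-length (a ∷ as) (b ∷ bs) same = cong suc (sameOrder-length as bs (∧-trueʳ same))
  where
  ∧-trueʳ : ∀ {u v} → u ∧ v ≡ true → v ≡ true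
  ∧-trueʳ {true} v≡true = v≡true
sameOrder-length [] (_ ∷ _) ()
sameOrder-length (_ ∷ _) [] ()

t123 t132 : List ℕ
t123 = 1 ∷ 2 ∷ 3 ∷ []
t132 = 1 ∷ 3 ∷ 2 ∷ []

startsPattern : ℕ → List ℕ → Bool
startsPattern x s = sameOrder (x ∷ s) t123 ∨ sameOrder (x ∷ s) t132

startsPattern-length : ∀ x → OnlyTrueAtLength 2 (startsPattern x)
startsPattern-length x s yes with sameOrder (x ∷ s) t123 in e123 | sameOrder (x ∷ s) t132 in e132
... | true | _ = suc-injective (sameOrder-length (x ∷ s) t123 e123)
... | false | true = suc-injective (sameOrder-length (x ∷ s) t132 e132)

startsPattern-pair : ∀ x a b → startsPattern x (a ∷ b ∷ []) ≡ (x <ᵇ a) ∧ (x <ᵇ b)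
startsPattern-pair x a b with x <ᵇ a | x <ᵇ b | a <ᵇ b
... | true | true | true = refl
... | true | true | false = refl
... | true | false | true = refl
... | true | false | false = refl
... | false | true | true = refl
... | false | true | false = refl
... | false | false | true = refl
... | false | false | false = refl

anyPair-greater : ∀ x st → anyPair (λ a b → (x <ᵇ a) ∧ (x <ᵇ b)) st ≡ not (canPush x st)
anyPair-greater x [] = refl
anyPair-greater x (a ∷ as) with x <ᵇ a
... | false = trans (cong (_∨ anyPair _ as) (any-false _ as (λ _ → refl))) (anyPair-greater x as)
... | true = trans (cong₂ _∨_ (any-greater as) (anyPair-greater x as)) (more-than-one (countGreater x as))
  where
  any-greater : ∀ as → any (x <ᵇ_) as ≡ not (countGreater x as ≤ᵇ 0)
  any-greater [] = refl
  any-greater (b ∷ bs) with x <ᵇ b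
  ... | true = refl
  ... | false = any-greater bs
  more-than-one : ∀ c → not (c ≤ᵇ 0) ∨ not (c ≤ᵇ 1) ≡ not (suc c ≤ᵇ 1)
  more-than-one zero = refl
  more-than-one (suc c) = refl

contains-∷ : ∀ x st τ → contains (x ∷ st) τ ≡ any (λ s → sameOrder (x ∷ s) τ) (subseqs st) ∨ contains st τ
contains-∷ x st τ = any-subseqs-∷ (λ s → sameOrder s τ) x st

okStack-∷ : ∀ x st → okStack (x ∷ st) ≡ canPush x st ∧ okStack st
okStack-∷ x st = begin
  okStack (x ∷ st)
    ≡⟨ cong₂ (λ u v → not u ∧ not v) (contains-∷ x st t123) (contains-∷ x st t132) ⟩
  not (any₁₂₃ ∨ contains st t123) ∧ not (any₁₃₂ ∨ contains st t132)
    ≡⟨ regroup any₁₂₃ (contains st t123) any₁₃₂ (contains st t132) ⟩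
  not (any₁₂₃ ∨ any₁₃₂) ∧ okStack st
    ≡⟨ cong (λ u → not u ∧ okStack st) (any-∨ _ _ (subseqs st)) ⟩
  not (any (startsPattern x) (subseqs st)) ∧ okStack st
    ≡⟨ cong (λ u → not u ∧ okStack st) (any-subseqs-length2 (startsPattern x) st (startsPattern-length x)) ⟩
  not (anyPair (λ a b → startsPattern x (a ∷ b ∷ [])) st) ∧ okStack st
    ≡⟨ cong (λ u → not u ∧ okStack st) (anyPair-cong st (startsPattern-pair x)) ⟩
  not (anyPair (λ a b → (x <ᵇ a) ∧ (x <ᵇ b)) st) ∧ okStack st
    ≡⟨ cong (λ u → not u ∧ okStack st) (anyPair-greater x st) ⟩
  not (not (canPush x st)) ∧ okStack st
    ≡⟨ cong (_∧ okStack st) (not-involutive (canPush x st)) ⟩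
  canPush x st ∧ okStack st ∎
  where
  open ≡-Reasoning
  any₁₂₃ = any (λ s → sameOrder (x ∷ s) t123) (subseqs st)
  any₁₃₂ = any (λ s → sameOrder (x ∷ s) t132) (subseqs st)
  regroup : ∀ a b c d → not (a ∨ b) ∧ not (c ∨ d) ≡ not (a ∨ c) ∧ (not b ∧ not d)
  regroup true b c d = refl
  regroup false b true d = ∧-zeroʳ (not b)
  regroup false b false d = refl
  anyPair-cong : ∀ {h g : ℕ → ℕ → Bool} xs → (∀ a b → h a b ≡ g a b) → anyPair h xs ≡ anyPair g xs
  anyPair-cong [] _ = refl
  anyPair-cong (a ∷ as) h≗g = cong₂ _∨_ (any-cong as (h≗g a)) (anyPair-cong as h≗g)

okStack-push : ∀ x st → okStack (x ∷ st) ≡ true → canPush x st ≡ true × okStack st ≡ true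
okStack-push x st ok with canPush x st | okStack st | okStack-∷ x st
... | true | true | _ = refl , refl
... | true | false | split = case trans (sym ok) split of λ ()
... | false | _ | split = case trans (sym ok) split of λ ()

okStack-reject : ∀ x st → okStack st ≡ true → okStack (x ∷ st) ≡ false → canPush x st ≡ false
okStack-reject x st ok rejected with canPush x st | okStack-∷ x st
... | false | _ = refl
... | true | split = case trans (sym rejected) (trans split ok) of λ ()

private
  fuel-push : ∀ L S f → 2 * suc L + S ≤ suc f → 2 * L + suc S ≤ f
  fuel-push L S f le = ≤-pred (subst (_≤ suc f) (measure L S) le)
    where
    measure : ∀ L S → 2 * suc L + S ≡ suc (2 * L + suc S)
    measure = solve-∀

run≡machine : ∀ f inp st out → okStack st ≡ true → 2 * length inp + length st ≤ f → run f inp st out ≡ out ++ machine inp st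
run≡machine zero [] st out _ _ = refl
run≡machine (suc f) [] st out _ _ = refl
run≡machine (suc f) (x ∷ xs) st out ok fuel with okStack (x ∷ st) in ok′
... | true = begin
  run f xs (x ∷ st) out           ≡⟨ run≡machine f xs (x ∷ st) out ok′ (fuel-push (length xs) (length st) f fuel) ⟩
  out ++ machine xs (x ∷ st)      ≡⟨ cong (out ++_) (machine-push xs st (proj₁ (okStack-push x st ok′))) ⟨
  out ++ machine (x ∷ xs) st      ∎
  where open ≡-Reasoning
... | false with st
...   | y ∷ ys = begin
  run f (x ∷ xs) ys (out ++ [ y ])
    ≡⟨ run≡machine f (x ∷ xs) ys (out ++ [ y ]) (proj₂ (okStack-push y ys ok)) fuel′ ⟩
  (out ++ [ y ]) ++ machine (x ∷ xs) ys
    ≡⟨ ++-assoc out [ y ] _ ⟩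
  out ++ y ∷ machine (x ∷ xs) ys
    ≡⟨ cong (out ++_) (machine-pop xs y ys (okStack-reject x (y ∷ ys) ok ok′)) ⟨
  out ++ machine (x ∷ xs) (y ∷ ys) ∎
  where
  open ≡-Reasoning
  fuel′ : 2 * length (x ∷ xs) + length ys ≤ f
  fuel′ = ≤-pred (subst (_≤ suc f) (+-suc _ (length ys)) fuel)

s123,132≗stackSort : ∀ π → s123,132 π ≡ stackSort π
s123,132≗stackSort π = run≡machine (2 * length π) π [] [] refl (≤-reflexive (+-identityʳ _))

popped++kept : ∀ x st → popped x st ++ kept x st ≡ st
popped++kept x [] = refl
popped++kept x (y ∷ ys) with canPush x (y ∷ ys)
... | true = refl
... | false = cong (y ∷_) (popped++kept x ys)

machine-↭ : ∀ inp st → machine inp st ↭ st ++ inp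
machine-↭ [] st = ↭-reflexive (sym (++-identityʳ st))
machine-↭ (x ∷ xs) st = begin
  machine (x ∷ xs) st
    ≡⟨ machine-∷ x xs st ⟩
  popped x st ++ machine xs (x ∷ kept x st)
    ↭⟨ ++⁺ˡ (popped x st) (machine-↭ xs (x ∷ kept x st)) ⟩
  popped x st ++ x ∷ kept x st ++ xs
    ↭⟨ shift x (popped x st) (kept x st ++ xs) ⟩
  x ∷ popped x st ++ kept x st ++ xs
    ≡⟨ cong (x ∷_) (trans (sym (++-assoc (popped x st) _ xs)) (cong (_++ xs) (popped++kept x st))) ⟩
  x ∷ st ++ xs
    ↭⟨ shift x st xs ⟨
  st ++ x ∷ xs ∎
  where open PermutationReasoning

length-machine : ∀ inp st → length (machine inp st) ≡ length st + length inp
length-machine inp st = trans (↭-length (machine-↭ inp st)) (length-++ st)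

machine-++ : ∀ xs ys st → machine (xs ++ ys) st ≡ emitted xs st ++ machine ys (stackAfter xs st)
machine-++ [] ys st = refl
machine-++ (x ∷ xs) ys st = begin
  machine (x ∷ xs ++ ys) st
    ≡⟨ machine-∷ x (xs ++ ys) st ⟩
  popped x st ++ machine (xs ++ ys) (x ∷ kept x st)
    ≡⟨ cong (popped x st ++_) (machine-++ xs ys (x ∷ kept x st)) ⟩
  popped x st ++ emitted xs (x ∷ kept x st) ++ machine ys _
    ≡⟨ ++-assoc (popped x st) _ _ ⟨
  emitted (x ∷ xs) st ++ machine ys (stackAfter (x ∷ xs) st) ∎
  where open ≡-Reasoning

stackSort-↭ : ∀ α → stackSort α ↭ α
stackSort-↭ α = machine-↭ α []

length-stackSort : ∀ α → length (stackSort α) ≡ length α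
length-stackSort α = length-machine α []

length-∷ʳ : ∀ (xs : List ℕ) x → length (xs ++ [ x ]) ≡ suc (length xs)
length-∷ʳ xs x = trans (length-++ xs) (+-comm (length xs) 1)

<ᵇ-true : ∀ {x y} → x < y → (x <ᵇ y) ≡ true
<ᵇ-true x<y = Equivalence.to T-≡ (<⇒<ᵇ x<y)

<ᵇ-false : ∀ {x y} → y ≤ x → (x <ᵇ y) ≡ false
<ᵇ-false {x} {y} y≤x with x <ᵇ y in x<ᵇy
... | false = refl
... | true = contradiction (<ᵇ⇒< x y (Equivalence.from T-≡ x<ᵇy)) (≤⇒≯ y≤x)

canPush⇒≤1 : ∀ {x} st → canPush x st ≡ true → countGreater x st ≤ 1
canPush⇒≤1 {x} st push = ≤ᵇ⇒≤ (countGreater x st) 1 (Equivalence.from T-≡ push)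

≤1⇒canPush : ∀ {x} st → countGreater x st ≤ 1 → canPush x st ≡ true
≤1⇒canPush st ≤1 = Equivalence.to T-≡ (≤⇒≤ᵇ ≤1)

canPush-kept : ∀ x st → canPush x (kept x st) ≡ true
canPush-kept x [] = refl
canPush-kept x (y ∷ ys) with canPush x (y ∷ ys) in push
... | true = push
... | false = canPush-kept x ys

countGreater-++ : ∀ x l₁ l₂ → countGreater x (l₁ ++ l₂) ≡ countGreater x l₁ + countGreater x l₂
countGreater-++ x [] l₂ = refl
countGreater-++ x (y ∷ l₁) l₂ with x <ᵇ y
... | true = cong suc (countGreater-++ x l₁ l₂)
... | false = countGreater-++ x l₁ l₂

countGreater-↭ : ∀ x {l₁ l₂} → l₁ ↭ l₂ → countGreater x l₁ ≡ countGreater x l₂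
countGreater-↭ x refl = refl
countGreater-↭ x (prep y p) with x <ᵇ y
... | true = cong suc (countGreater-↭ x p)
... | false = countGreater-↭ x p
countGreater-↭ x (swap y z p) with x <ᵇ y | x <ᵇ z
... | true | true = cong (suc ∘ suc) (countGreater-↭ x p)
... | true | false = cong suc (countGreater-↭ x p)
... | false | true = cong suc (countGreater-↭ x p)
... | false | false = countGreater-↭ x p
countGreater-↭ x (_↭_.trans p q) = trans (countGreater-↭ x p) (countGreater-↭ x q)

countGreater≤length : ∀ x l → countGreater x l ≤ length l
countGreater≤length x [] = z≤n
countGreater≤length x (y ∷ l) with x <ᵇ y
... | true = s≤s (countGreater≤length x l)
... | false = m≤n⇒m≤1+n (countGreater≤length x l)

countGreater-all : ∀ {x} l → All (x <_) l → countGreater x l ≡ length l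
countGreater-all [] [] = refl
countGreater-all (y ∷ l) (x<y ∷ x<l) rewrite <ᵇ-true x<y = cong suc (countGreater-all l x<l)

countGreater-antitone : ∀ {x y} l → x ≤ y → countGreater y l ≤ countGreater x l
countGreater-antitone [] _ = z≤n
countGreater-antitone {x} {y} (z ∷ l) x≤y with y <ᵇ z in y<ᵇz | x <ᵇ z in x<ᵇz
... | true | true = s≤s (countGreater-antitone l x≤y)
... | false | true = m≤n⇒m≤1+n (countGreater-antitone l x≤y)
... | false | false = countGreater-antitone l x≤y
... | true | false = contradiction (trans (sym (<ᵇ-true x<z)) x<ᵇz) λ ()
  where
  x<z : x < z
  x<z = ≤-<-trans x≤y (<ᵇ⇒< y z (Equivalence.from T-≡ y<ᵇz))

canPush-above : ∀ {x y} B → x ≤ y → canPush x B ≡ true → canPush y (x ∷ B) ≡ true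
canPush-above B x≤y push rewrite <ᵇ-false x≤y = ≤1⇒canPush B (≤-trans (countGreater-antitone B x≤y) (canPush⇒≤1 B push))

length-kept : ∀ x st → length (kept x st) + countGreater x st ≤ suc (length st)
length-kept x st = begin
  length K + countGreater x st
    ≡⟨ cong (λ l → length K + countGreater x l) (popped++kept x st) ⟨
  length K + countGreater x (O ++ K)
    ≡⟨ cong (length K +_) (countGreater-++ x O K) ⟩
  length K + (countGreater x O + countGreater x K)
    ≤⟨ +-monoʳ-≤ (length K) (+-mono-≤ (countGreater≤length x O) (canPush⇒≤1 K (canPush-kept x st))) ⟩
  length K + (length O + 1)
    ≡⟨ regroup (length K) (length O) ⟩
  suc (length O + length K)
    ≡⟨ cong suc (length-++ O) ⟨
  suc (length (O ++ K))
    ≡⟨ cong (suc ∘ length) (popped++kept x st) ⟩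
  suc (length st) ∎
  where
  open ≤-Reasoning
  O = popped x st
  K = kept x st
  regroup : ∀ k o → k + (o + 1) ≡ suc (o + k)
  regroup = solve-∀

length-kept-after : ∀ x L → length (kept x (stackAfter L [])) + countGreater x L ≤ suc (length L)
length-kept-after x L = begin
  length B + countGreater x L
    ≡⟨ cong (length B +_) (trans (countGreater-↭ x (↭-sym (machine-↭ L []))) (countGreater-++ x E st)) ⟩
  length B + (countGreater x E + countGreater x st)
    ≤⟨ +-monoʳ-≤ (length B) (+-monoˡ-≤ (countGreater x st) (countGreater≤length x E)) ⟩
  length B + (length E + countGreater x st)
    ≡⟨ regroup (length B) (length E) (countGreater x st) ⟩
  length E + (length B + countGreater x st)
    ≤⟨ +-monoʳ-≤ (length E) (length-kept x st) ⟩
  length E + suc (length st)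
    ≡⟨ +-suc (length E) (length st) ⟩
  suc (length E + length st)
    ≡⟨ cong suc (trans (sym (length-++ E)) (length-machine L [])) ⟩
  suc (length L) ∎
  where
  open ≤-Reasoning
  E = emitted L []
  st = stackAfter L []
  B = kept x st
  regroup : ∀ b e c → b + (e + c) ≡ e + (b + c)
  regroup = solve-∀

split-above : ∀ k {y} → k < y → ∃ λ d → y ≡ k + suc d
split-above zero (s≤s {n = d} _) = d , refl
split-above (suc k) (s≤s k<y) with split-above k k<y
... | d , refl = d , refl

Unique-++⁻ˡ : ∀ xs {ys : List ℕ} → Unique (xs ++ ys) → Unique xs
Unique-++⁻ˡ [] _ = []
Unique-++⁻ˡ (x ∷ xs) (x∉ ∷ u) = All-++⁻ˡ xs x∉ ∷ Unique-++⁻ˡ xs u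

Unique-++⁻ʳ : ∀ xs {ys : List ℕ} → Unique (xs ++ ys) → Unique ys
Unique-++⁻ʳ [] u = u
Unique-++⁻ʳ (x ∷ xs) (_ ∷ u) = Unique-++⁻ʳ xs u

Unique-++-disjoint : ∀ xs {ys : List ℕ} {y} → Unique (xs ++ ys) → y ∈ xs → y ∉ ys
Unique-++-disjoint (x ∷ xs) (x∉ ∷ _) (here refl) y∈ys = All.lookup (All-++⁻ʳ xs x∉) y∈ys refl
Unique-++-disjoint (x ∷ xs) (_ ∷ u) (there y∈xs) = Unique-++-disjoint xs u y∈xs

Unique-suffix : ∀ C C′ {y : ℕ} {D D′} → Unique (C ++ y ∷ D) → C ++ y ∷ D ≡ C′ ++ y ∷ D′ → D ≡ D′
Unique-suffix [] [] _ refl = refl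
Unique-suffix [] (c ∷ C′) (y∉ ∷ _) refl = ⊥-elim (All.lookup y∉ (∈-++⁺ʳ C′ (here refl)) refl)
Unique-suffix (c ∷ C) [] (y∉ ∷ _) refl = ⊥-elim (All.lookup y∉ (∈-++⁺ʳ C (here refl)) refl)
Unique-suffix (c ∷ C) (c′ ∷ C′) (_ ∷ u) eq = Unique-suffix C C′ u (∷-injectiveʳ eq)

Unique-↭ : ∀ {l₁ l₂ : List ℕ} → l₁ ↭ l₂ → Unique l₁ → Unique l₂
Unique-↭ p = Permutationₛ.Unique-resp-↭ (setoid ℕ) (↭⇒↭ₛ p)

All-≤⇒All-< : ∀ {x} {l : List ℕ} → All (x ≤_) l → x ∉ l → All (x <_) l
All-≤⇒All-< [] _ = []
All-≤⇒All-< (x≤y ∷ x≤l) x∉ = ≤∧≢⇒< x≤y (λ x≡y → x∉ (here x≡y)) ∷ All-≤⇒All-< x≤l (x∉ ∘ there)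

∷ʳ-view : ∀ (q : List ℕ) h → ∃₂ λ c q′ → q ++ [ h ] ≡ c ∷ q′
∷ʳ-view [] h = h , [] , refl
∷ʳ-view (c ∷ cs) h = c , cs ++ [ h ] , refl

length-∷ʳ-tail : ∀ (q : List ℕ) {h c q′} → q ++ [ h ] ≡ c ∷ q′ → length q′ ≡ length q
length-∷ʳ-tail q {h} q∷ʳh = suc-injective (trans (cong length (sym q∷ʳh)) (length-∷ʳ q h))

∈-take-++ : ∀ {x : ℕ} r xs {ys} → x ∈ take r xs → x ∈ take r (xs ++ ys)
∈-take-++ (suc r) (y ∷ xs) (here x≡y) = here x≡y
∈-take-++ (suc r) (y ∷ xs) (there x∈) = there (∈-take-++ r xs x∈)

-- Appending h and dropping the first entry moves every other entry one place forward.
∈-take-shift : ∀ {x h r : ℕ} (q : List ℕ) {c q′} → Unique q → q ++ [ h ] ≡ c ∷ q′ → x ≢ h →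
  (x ∈ q → x ∈ take (suc r) q) → x ∈ q′ → x ∈ take r q′
∈-take-shift [] _ refl _ _ ()
∈-take-shift {x} {h} {r} (c ∷ cs) (c∉cs ∷ _) refl x≢h near x∈q′ with ∈-++⁻ cs x∈q′
... | inj₂ (here x≡h) = contradiction x≡h x≢h
... | inj₁ x∈cs with near (there x∈cs)
...   | here x≡c = contradiction (sym x≡c) (All.lookup c∉cs x∈cs)
...   | there x∈take = ∈-take-++ r cs x∈take

AmongLast : ℕ → ℕ → List ℕ → Set
AmongLast N x l = ∃₂ λ P S → l ≡ P ++ x ∷ S × length S < N

AmongLast-++ˡ : ∀ {N x l} O → AmongLast N x l → AmongLast N x (O ++ l)
AmongLast-++ˡ O (P , S , refl , short) = O ++ P , S , sym (++-assoc O P _) , short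

AmongLast-mono : ∀ {N N′ x l} → N ≤ N′ → AmongLast N x l → AmongLast N′ x l
AmongLast-mono N≤N′ (P , S , l≡ , short) = P , S , l≡ , <-≤-trans short N≤N′

AmongLast-∈ˡ : ∀ {N x} A {B} → Unique (A ++ B) → x ∈ A → AmongLast N x (A ++ B) →
  ∃₂ λ A₁ A₂ → A ≡ A₁ ++ x ∷ A₂ × length A₂ + length B < N
AmongLast-∈ˡ {N} {x} A {B} u x∈A (P , S , A++B≡ , short) with ∈-∃++ x∈A
... | A₁ , A₂ , refl = A₁ , A₂ , refl , subst (_< N) (trans (cong length (sym suffix)) (length-++ A₂)) short
  where
  suffix : A₂ ++ B ≡ S
  suffix = Unique-suffix A₁ P (subst Unique (++-assoc A₁ _ B) u) (trans (sym (++-assoc A₁ _ B)) A++B≡)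

AmongLast-cut : ∀ {N x} A {B} → Unique (A ++ B) → x ∈ A → AmongLast (length B + N) x (A ++ B) → AmongLast N x A
AmongLast-cut {N} A {B} u x∈A near with AmongLast-∈ˡ A u x∈A near
... | A₁ , A₂ , refl , short =
  A₁ , A₂ , refl , +-cancelˡ-< (length B) (length A₂) N (subst (_< length B + N) (+-comm (length A₂) (length B)) short)

AmongLast-++ʳ : ∀ {N x A} B → AmongLast N x A → AmongLast (length B + N) x (A ++ B)
AmongLast-++ʳ {N} {x} B (P , S , refl , short) =
  P , S ++ B , ++-assoc P (x ∷ S) B ,
  subst (_< length B + N) (sym (trans (length-++ S) (+-comm (length S) (length B)))) (+-monoʳ-< (length B) short)

AmongLast-head : ∀ {N h rest} → Unique (h ∷ rest) → AmongLast N h (h ∷ rest) → length rest < N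
AmongLast-head {h = h} {rest} u near with AmongLast-∈ˡ [ h ] {rest} u (here refl) near
... | _ , A₂ , _ , short = ≤-<-trans (m≤n+m (length rest) (length A₂)) short

AmongLast-last : ∀ {N} P x → AmongLast (suc N) x (P ++ [ x ])
AmongLast-last P x = P , [] , refl , s≤s z≤n

AmongLast-2⇒second-to-last : ∀ {x h} P → AmongLast 2 x (P ++ [ h ]) → x ≢ h → ∃ λ C → P ≡ C ++ [ x ]
AmongLast-2⇒second-to-last P (C , [] , eq , _) x≢h = contradiction (sym (proj₂ (∷ʳ-injective P C eq))) x≢h
AmongLast-2⇒second-to-last {x} P (C , d ∷ [] , eq , _) _ =
  C , ∷ʳ-injectiveˡ P (C ++ [ x ]) (trans eq (sym (++-assoc C [ x ] [ d ])))
AmongLast-2⇒second-to-last P (C , _ ∷ _ ∷ _ , _ , s≤s (s≤s ())) _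

-- The Tail Lemma

pops-within : ∀ y T z →
  (∃ λ T′ → kept y (T ++ z) ≡ T′ ++ z) ⊎ (popped y (T ++ z) ≡ T ++ popped y z × kept y (T ++ z) ≡ kept y z)
pops-within y [] z = inj₂ (refl , refl)
pops-within y (t ∷ T) z with canPush y (t ∷ T ++ z)
... | true = inj₁ (t ∷ T , refl)
... | false with pops-within y T z
...   | inj₁ within = inj₁ within
...   | inj₂ (popped≡ , kept≡) = inj₂ (cong (t ∷_) popped≡ , kept≡)

machine-keeps-near-end : ∀ inp T x B → AmongLast (suc (length inp + length B)) x (machine inp (T ++ x ∷ B))
machine-keeps-near-end [] T x B = T , B , refl , ≤-refl
machine-keeps-near-end (y ∷ ys) T x B rewrite machine-∷ y ys (T ++ x ∷ B) with pops-within y T (x ∷ B)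
... | inj₁ (T′ , kept≡) rewrite kept≡ =
  AmongLast-++ˡ (popped y (T ++ x ∷ B))
    (AmongLast-mono (s≤s (+-monoˡ-≤ (length B) (n≤1+n _))) (machine-keeps-near-end ys (y ∷ T′) x B))
... | inj₂ (popped≡ , kept≡) rewrite popped≡ | kept≡ with canPush y (x ∷ B) in push
...   | true = AmongLast-++ˡ (T ++ []) (AmongLast-mono (s≤s (+-monoˡ-≤ (length B) (n≤1+n _))) (machine-keeps-near-end ys [ y ] x B))
...   | false = T , rest , ++-assoc T (x ∷ popped y B) _ , s≤s (≤-reflexive length-rest)
  where
  rest : List ℕ
  rest = popped y B ++ machine ys (y ∷ kept y B)
  length-rest : length rest ≡ length (y ∷ ys) + length B
  length-rest = begin
    length rest
      ≡⟨ length-++ (popped y B) ⟩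
    length (popped y B) + length (machine ys (y ∷ kept y B))
      ≡⟨ cong (length (popped y B) +_) (length-machine ys (y ∷ kept y B)) ⟩
    length (popped y B) + (suc (length (kept y B)) + length ys)
      ≡⟨ regroup (length (popped y B)) (length (kept y B)) (length ys) ⟩
    suc (length ys) + (length (popped y B) + length (kept y B))
      ≡⟨ cong (λ l → suc (length ys) + l) (trans (sym (length-++ (popped y B))) (cong length (popped++kept y B))) ⟩
    suc (length ys) + length B ∎
    where
    open ≡-Reasoning
    regroup : ∀ a b c → a + (suc b + c) ≡ suc c + (a + b)
    regroup = solve-∀

stackAfter-above : ∀ inp T x B → All (λ y → canPush y (x ∷ B) ≡ true) inp →
  ∃ λ T′ → stackAfter inp (T ++ x ∷ B) ≡ T′ ++ x ∷ B
stackAfter-above [] T x B [] = T , refl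
stackAfter-above (y ∷ ys) T x B (push ∷ pushes) with pops-within y T (x ∷ B)
... | inj₁ (T′ , kept≡) rewrite kept≡ = stackAfter-above ys (y ∷ T′) x B pushes
... | inj₂ (_ , kept≡) rewrite kept≡ | proj₂ (canPush⇒no-pops (x ∷ B) push) = stackAfter-above ys [ y ] x B pushes

-- b is the number of entries below x right after x is pushed; the entries of R₁
-- never pop x, so only R₂ and those b entries can follow x in the output.
stackSort-position : ∀ L x R₁ R₂ → All (x ≤_) R₁ →
  ∃ λ b → b + countGreater x L ≤ suc (length L) × AmongLast (suc (length R₂ + b)) x (stackSort (L ++ x ∷ R₁ ++ R₂))
stackSort-position L x R₁ R₂ x≤R₁ = length B , length-kept-after x L , subst (AmongLast _ x) (sym output) near-end
  where
  E = emitted L []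
  st = stackAfter L []
  B = kept x st
  pushes : All (λ y → canPush y (x ∷ B) ≡ true) R₁
  pushes = All.map (λ x≤y → canPush-above B x≤y (canPush-kept x st)) x≤R₁
  above = stackAfter-above R₁ [] x B pushes
  T′ = proj₁ above
  output : stackSort (L ++ x ∷ R₁ ++ R₂) ≡ E ++ popped x st ++ emitted R₁ (x ∷ B) ++ machine R₂ (T′ ++ x ∷ B)
  output = begin
    machine (L ++ x ∷ R₁ ++ R₂) []
      ≡⟨ machine-++ L (x ∷ R₁ ++ R₂) [] ⟩
    E ++ machine (x ∷ R₁ ++ R₂) st
      ≡⟨ cong (E ++_) (machine-∷ x (R₁ ++ R₂) st) ⟩
    E ++ popped x st ++ machine (R₁ ++ R₂) (x ∷ B)
      ≡⟨ cong (λ l → E ++ popped x st ++ l) (machine-++ R₁ R₂ (x ∷ B)) ⟩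
    E ++ popped x st ++ emitted R₁ (x ∷ B) ++ machine R₂ (stackAfter R₁ (x ∷ B))
      ≡⟨ cong (λ l → E ++ popped x st ++ emitted R₁ (x ∷ B) ++ machine R₂ l) (proj₂ above) ⟩
    E ++ popped x st ++ emitted R₁ (x ∷ B) ++ machine R₂ (T′ ++ x ∷ B) ∎
    where open ≡-Reasoning
  near-end : AmongLast (suc (length R₂ + length B)) x (E ++ popped x st ++ emitted R₁ (x ∷ B) ++ machine R₂ (T′ ++ x ∷ B))
  near-end = AmongLast-++ˡ E (AmongLast-++ˡ (popped x st)
               (AmongLast-++ˡ (emitted R₁ (x ∷ B)) (machine-keeps-near-end R₂ T′ x B)))

split-suffix : ∀ (l : List ℕ) M →
  ∃₂ λ l₁ l₂ → l ≡ l₁ ++ l₂ × length l₂ ≤ M × (length l₂ ≡ M ⊎ l₁ ≡ [])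
split-suffix [] M = [] , [] , refl , z≤n , inj₂ refl
split-suffix (x ∷ l) M with split-suffix l M
... | l₁ , l₂ , refl , short , inj₁ full = x ∷ l₁ , l₂ , refl , short , inj₁ full
... | [] , l₂ , refl , short , inj₂ refl with m≤n⇒m<n∨m≡n short
...   | inj₁ shorter = [] , x ∷ l₂ , refl , shorter , inj₂ refl
...   | inj₂ full = [ x ] , l₂ , refl , short , inj₁ full

smaller-in-suffix : ∀ {α x M} → Unique α → (∀ y → y ∈ α → y < x → AmongLast M y α) →
  ∃₂ λ α₁ α₂ → α ≡ α₁ ++ α₂ × length α₂ ≤ M × All (x ≤_) α₁
smaller-in-suffix {α} {x} {M} u near with split-suffix α M
... | α₁ , α₂ , refl , short , side =
  α₁ , α₂ , refl , short , All.tabulate λ {y} y∈α₁ → ≮⇒≥ λ y<x → not-near side y∈α₁ (near y (∈-++⁺ˡ y∈α₁) y<x)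
  where
  not-near : ∀ {y} → length α₂ ≡ M ⊎ α₁ ≡ [] → y ∈ α₁ → AmongLast M y (α₁ ++ α₂) → ⊥
  not-near (inj₂ refl) ()
  not-near (inj₁ full) y∈α₁ near-y with AmongLast-∈ˡ α₁ u y∈α₁ near-y
  ... | _ , A₂ , _ , short′ = <⇒≱ short′ (subst (_≤ length A₂ + length α₂) full (m≤n+m (length α₂) (length A₂)))

private
  cancel-below : ∀ {b c a d} → b + c ≤ suc (a + d) → a ≤ c → b ≤ suc d
  cancel-below {b} {c} {a} {d} le a≤c = +-cancelʳ-≤ a b (suc d) (begin
    b + a          ≤⟨ +-monoʳ-≤ b a≤c ⟩
    b + c          ≤⟨ le ⟩
    suc (a + d)    ≡⟨ cong suc (+-comm a d) ⟩
    suc d + a      ∎)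
    where open ≤-Reasoning

-- Outside its last M entries α has no entry below x.  The entries before x that exceed x
-- are all popped when x arrives except at most one, which bounds b in stackSort-position.
tail-lemma : ∀ {α x M} → Unique α → x ∈ α → (∀ y → y ∈ α → y < x → AmongLast M y α) →
  AmongLast (2 + M) x (stackSort α)
tail-lemma {α} {x} {M} u x∈α near with smaller-in-suffix u near
... | α₁ , α₂ , refl , short , x≤α₁ with ∈-++⁻ α₁ x∈α
...   | inj₁ x∈α₁ = in-prefix (∈-∃++ x∈α₁)
  where
  in-prefix : (∃₂ λ C₁ C₂ → α₁ ≡ C₁ ++ x ∷ C₂) → AmongLast (2 + M) x (stackSort (α₁ ++ α₂))
  in-prefix (C₁ , C₂ , refl) with stackSort-position C₁ x C₂ α₂ (All.tail (All-++⁻ʳ C₁ x≤α₁))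
  ... | b , bound , near-x = subst (AmongLast _ x ∘ stackSort) (sym (++-assoc C₁ (x ∷ C₂) α₂))
        (AmongLast-mono (s≤s (subst (length α₂ + b ≤_) (+-comm M 1) (+-mono-≤ short b≤1))) near-x)
    where
    x∉C₁ : x ∉ C₁
    x∉C₁ x∈C₁ = Unique-++-disjoint C₁ (subst Unique (++-assoc C₁ (x ∷ C₂) α₂) u) x∈C₁ (here refl)
    b≤1 : b ≤ 1
    b≤1 = cancel-below (subst (λ l → b + countGreater x C₁ ≤ suc l) (sym (+-identityʳ (length C₁))) bound)
                       (≤-reflexive (sym (countGreater-all C₁ (All-≤⇒All-< (All-++⁻ˡ C₁ x≤α₁) x∉C₁))))
...   | inj₂ x∈α₂ = in-suffix (∈-∃++ x∈α₂)
  where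
  x<α₁ : All (x <_) α₁
  x<α₁ = All-≤⇒All-< x≤α₁ (λ x∈α₁ → Unique-++-disjoint α₁ u x∈α₁ x∈α₂)
  in-suffix : (∃₂ λ A₁ A₂ → α₂ ≡ A₁ ++ x ∷ A₂) → AmongLast (2 + M) x (stackSort (α₁ ++ α₂))
  in-suffix (A₁ , A₂ , refl) with stackSort-position (α₁ ++ A₁) x [] A₂ []
  ... | b , bound , near-x = subst (AmongLast _ x ∘ stackSort) (++-assoc α₁ A₁ (x ∷ A₂))
        (AmongLast-mono (s≤s (≤-trans (≤-trans (+-monoʳ-≤ (length A₂) b≤) length≤) (m≤n⇒m≤1+n short))) near-x)
    where
    b≤ : b ≤ suc (length A₁)
    b≤ = cancel-below (subst (λ l → b + countGreater x (α₁ ++ A₁) ≤ suc l) (length-++ α₁) bound)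
           (≤-trans (≤-reflexive (sym (countGreater-all α₁ x<α₁)))
                    (subst (countGreater x α₁ ≤_) (sym (countGreater-++ x α₁ A₁)) (m≤m+n _ _)))
    length≤ : length A₂ + suc (length A₁) ≤ length (A₁ ++ x ∷ A₂)
    length≤ = ≤-reflexive (trans (+-comm (length A₂) _) (sym (trans (length-++ A₁) (+-suc _ _))))

-- Zigzags

zigzag : List ℕ → List ℕ
zigzag [] = []
zigzag (c ∷ cs) = suc (length cs) ∷ c ∷ zigzag cs

zigzagTail : List ℕ → List ℕ
zigzagTail [] = []
zigzagTail (c ∷ cs) = c ∷ zigzag cs

zigzag-∷ʳ : ∀ q h → zigzag (q ++ [ h ]) ≡ suc (length q) ∷ zigzagTail (q ++ [ h ])
zigzag-∷ʳ [] h = refl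
zigzag-∷ʳ (c ∷ cs) h = cong (λ l → suc l ∷ c ∷ zigzag (cs ++ [ h ])) (length-∷ʳ cs h)

canPush-singleton : ∀ y h → canPush y [ h ] ≡ true
canPush-singleton y h with y <ᵇ h
... | true = refl
... | false = refl

machine-pop-all : ∀ {k} T h xs → All (k <_) (T ++ [ h ]) → machine (k ∷ xs) (T ++ [ h ]) ≡ T ++ machine xs (k ∷ h ∷ [])
machine-pop-all [] h xs _ = machine-push xs [ h ] (canPush-singleton _ h)
machine-pop-all {k} (t ∷ T) h xs k<all =
  trans (machine-pop xs t (T ++ [ h ]) no-push) (cong (t ∷_) (machine-pop-all T h xs (All.tail k<all)))
  where
  no-push : canPush k (t ∷ T ++ [ h ]) ≡ false
  no-push = cong (_≤ᵇ 1) (trans (countGreater-all (t ∷ T ++ [ h ]) k<all) (cong suc (length-∷ʳ T h)))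

-- Each label pops the two entries above h and is then covered by the next entry of q.
machine-zigzag : ∀ c cs h → All (length cs <_) (c ∷ h ∷ cs) →
  machine (zigzag cs) (c ∷ suc (length cs) ∷ h ∷ []) ≡ c ∷ zigzag (cs ++ [ h ])
machine-zigzag c [] h _ = refl
machine-zigzag c (c₁ ∷ cs) h (L<c ∷ L<h ∷ L<c₁ ∷ L<cs) = begin
  machine (L ∷ c₁ ∷ zigzag cs) ((c ∷ suc L ∷ []) ++ [ h ])
    ≡⟨ machine-pop-all (c ∷ suc L ∷ []) h (c₁ ∷ zigzag cs) (L<c ∷ n<1+n L ∷ L<h ∷ []) ⟩
  c ∷ suc L ∷ machine (c₁ ∷ zigzag cs) (L ∷ h ∷ [])
    ≡⟨ cong (λ l → c ∷ suc L ∷ l) (machine-push (zigzag cs) _ (canPush-above [ h ] (<⇒≤ L<c₁) (canPush-singleton L h))) ⟩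
  c ∷ suc L ∷ machine (zigzag cs) (c₁ ∷ L ∷ h ∷ [])
    ≡⟨ cong (λ l → c ∷ suc L ∷ l) (machine-zigzag c₁ cs h (<-weaken L<c₁ ∷ <-weaken L<h ∷ All.map <-weaken L<cs)) ⟩
  c ∷ suc L ∷ c₁ ∷ zigzag (cs ++ [ h ])
    ≡⟨ cong (λ l → c ∷ suc l ∷ c₁ ∷ zigzag (cs ++ [ h ])) (length-∷ʳ cs h) ⟨
  c ∷ zigzag (c₁ ∷ cs ++ [ h ]) ∎
  where
  open ≡-Reasoning
  L = suc (length cs)
  <-weaken : ∀ {y} → L < y → length cs < y
  <-weaken = <-trans (n<1+n (length cs))

machine-zigzag-start : ∀ T h q → All (length q <_) (T ++ [ h ]) → All (length q <_) q →
  machine (zigzag q) (T ++ [ h ]) ≡ T ++ zigzagTail (q ++ [ h ])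
machine-zigzag-start T h [] _ _ = refl
machine-zigzag-start T h (c ∷ cs) k<T++h (k<c ∷ k<cs) = begin
  machine (k ∷ c ∷ zigzag cs) (T ++ [ h ])
    ≡⟨ machine-pop-all T h (c ∷ zigzag cs) k<T++h ⟩
  T ++ machine (c ∷ zigzag cs) (k ∷ h ∷ [])
    ≡⟨ cong (T ++_) (machine-push (zigzag cs) _ (canPush-above [ h ] (<⇒≤ k<c) (canPush-singleton k h))) ⟩
  T ++ machine (zigzag cs) (c ∷ k ∷ h ∷ [])
    ≡⟨ cong (T ++_) (machine-zigzag c cs h (<-weaken k<c ∷ <-weaken (All.lookup k<T++h h∈T++h) ∷ All.map <-weaken k<cs)) ⟩
  T ++ c ∷ zigzag (cs ++ [ h ]) ∎
  where
  open ≡-Reasoning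
  k = suc (length cs)
  <-weaken : ∀ {y} → k < y → length cs < y
  <-weaken = <-trans (n<1+n (length cs))
  h∈T++h = ∈-++⁺ʳ T (here refl)

-- The bottom entry h of α never leaves the stack while α is read, since every entry
-- may be pushed onto a single one; the first label of the zigzag then pops down to h.
stackSort-zigzag : ∀ h rest q → All (length q <_) (h ∷ rest ++ q) →
  ∃ λ P → stackSort (h ∷ rest) ≡ P ++ [ h ] × stackSort (h ∷ rest ++ zigzag q) ≡ P ++ zigzagTail (q ++ [ h ])
stackSort-zigzag h rest q k< = E ++ T , sorted , sorted-with-zigzag
  where
  α = h ∷ rest
  E = emitted α []
  bottom = stackAfter-above rest [] h [] (All.tabulate λ {y} _ → canPush-singleton y h)
  T = proj₁ bottom
  sorted : stackSort α ≡ (E ++ T) ++ [ h ]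
  sorted = trans (cong (E ++_) (proj₂ bottom)) (sym (++-assoc E T [ h ]))
  k<α : All (length q <_) α
  k<α = All-++⁻ˡ α k<
  k<T++h : All (length q <_) (T ++ [ h ])
  k<T++h = All-++⁻ʳ E (subst (All _) (cong (E ++_) (proj₂ bottom)) (All-resp-↭ (↭-sym (machine-↭ α [])) k<α))
  sorted-with-zigzag : stackSort (α ++ zigzag q) ≡ (E ++ T) ++ zigzagTail (q ++ [ h ])
  sorted-with-zigzag = begin
    machine (α ++ zigzag q) []                ≡⟨ machine-++ α (zigzag q) [] ⟩
    E ++ machine (zigzag q) (stackAfter α []) ≡⟨ cong (λ st → E ++ machine (zigzag q) st) (proj₂ bottom) ⟩
    E ++ machine (zigzag q) (T ++ [ h ])      ≡⟨ cong (E ++_) (machine-zigzag-start T h q k<T++h (All-++⁻ʳ α k<)) ⟩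
    E ++ T ++ zigzagTail (q ++ [ h ])         ≡⟨ ++-assoc E T _ ⟨
    (E ++ T) ++ zigzagTail (q ++ [ h ])       ∎
    where open ≡-Reasoning

-- Periodic states

stackSort-pair : ∀ a b → stackSort (a ∷ b ∷ []) ≡ b ∷ a ∷ []
stackSort-pair a b = trans (machine-push [ b ] [] refl) (machine-push [] [ a ] (canPush-singleton b a))

stackSort-rotation : ∀ h rest q → stackSort (h ∷ rest) ≡ rest ++ [ h ] → All (length q <_) (h ∷ rest ++ q) →
  stackSort (h ∷ rest ++ zigzag q) ≡ rest ++ zigzagTail (q ++ [ h ])
stackSort-rotation h rest q rotates k< with stackSort-zigzag h rest q k<
... | P , sorted , sorted-with-zigzag = trans sorted-with-zigzag (cong (_++ _) (∷ʳ-injectiveˡ P rest (trans (sym sorted) rotates)))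

rotate : List ℕ → List ℕ
rotate [] = []
rotate (x ∷ xs) = xs ++ [ x ]

length-rotate : ∀ xs → length (rotate xs) ≡ length xs
length-rotate [] = refl
length-rotate (x ∷ xs) = length-∷ʳ xs x

rotate-All : ∀ {P : ℕ → Set} {xs} → All P xs → All P (rotate xs)
rotate-All [] = []
rotate-All (px ∷ pxs) = All-++⁺ pxs (px ∷ [])

zigzagAfter : ℕ → List ℕ → List ℕ
zigzagAfter w E = take w E ++ zigzag (drop w E)

zigzagAfter-++ : ∀ xs E → zigzagAfter (length xs) (xs ++ E) ≡ xs ++ zigzag E
zigzagAfter-++ [] E = refl
zigzagAfter-++ (x ∷ xs) E = cong (x ∷_) (zigzagAfter-++ xs E)

zigzagAfter-1 : ∀ l → zigzagAfter 1 l ≡ zigzagTail l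
zigzagAfter-1 [] = refl
zigzagAfter-1 (c ∷ l) = refl

stackSort-zigzagAfter : ∀ w E → 1 ≤ w → w ≤ 2 → w ≤ length E → All ((length E ∸ w) <_) E →
  stackSort (zigzagAfter w E) ≡ zigzagAfter w (rotate E)
stackSort-zigzagAfter 1 (a ∷ q) _ _ _ k< = trans (stackSort-rotation a [] q refl k<) (sym (zigzagAfter-1 (q ++ [ a ])))
stackSort-zigzagAfter 2 (a ∷ b ∷ q) _ _ _ k< =
  trans (stackSort-rotation a [ b ] q (stackSort-pair a b) k<) (cong (b ∷_) (sym (zigzagAfter-1 (q ++ [ a ]))))
stackSort-zigzagAfter 2 (a ∷ []) _ _ (s≤s ()) _
stackSort-zigzagAfter (suc (suc (suc _))) _ _ (s≤s (s≤s ())) _ _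

iterate-cong : ∀ {f g : List ℕ → List ℕ} → (∀ x → f x ≡ g x) → ∀ k x → iterate k f x ≡ iterate k g x
iterate-cong f≗g zero x = refl
iterate-cong {g = g} f≗g (suc k) x = trans (f≗g _) (cong g (iterate-cong f≗g k x))

iterate-suc′ : ∀ (f : List ℕ → List ℕ) k x → iterate (suc k) f x ≡ iterate k f (f x)
iterate-suc′ f zero x = refl
iterate-suc′ f (suc k) x = cong f (iterate-suc′ f k x)

iterate-rotate : ∀ xs ys → iterate (length xs) rotate (xs ++ ys) ≡ ys ++ xs
iterate-rotate [] ys = sym (++-identityʳ ys)
iterate-rotate (x ∷ xs) ys = begin
  iterate (suc (length xs)) rotate (x ∷ xs ++ ys)   ≡⟨ iterate-suc′ rotate (length xs) (x ∷ xs ++ ys) ⟩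
  iterate (length xs) rotate ((xs ++ ys) ++ [ x ])  ≡⟨ cong (iterate (length xs) rotate) (++-assoc xs ys [ x ]) ⟩
  iterate (length xs) rotate (xs ++ ys ++ [ x ])    ≡⟨ iterate-rotate xs (ys ++ [ x ]) ⟩
  (ys ++ [ x ]) ++ xs                               ≡⟨ ++-assoc ys [ x ] xs ⟩
  ys ++ x ∷ xs                                      ∎
  where open ≡-Reasoning

iterate-preserves : ∀ {P : List ℕ → Set} (r : List ℕ → List ℕ) → (∀ {E} → P E → P (r E)) →
  ∀ k {E} → P E → P (iterate k r E)
iterate-preserves r preserves zero pE = pE
iterate-preserves {P} r preserves (suc k) pE = preserves (iterate-preserves {P} r preserves k pE)

iterate-semiconj : ∀ {P : List ℕ → Set} (f g r : List ℕ → List ℕ) → (∀ {E} → P E → P (r E)) →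
  (∀ {E} → P E → f (g E) ≡ g (r E)) → ∀ k {E} → P E → iterate k f (g E) ≡ g (iterate k r E)
iterate-semiconj f g r preserves f∘g≗g∘r zero pE = refl
iterate-semiconj {P} f g r preserves f∘g≗g∘r (suc k) pE =
  trans (cong f (iterate-semiconj {P} f g r preserves f∘g≗g∘r k pE)) (f∘g≗g∘r (iterate-preserves {P} r preserves k pE))

zigzagAfter-periodic : ∀ w E → 1 ≤ w → w ≤ 2 → w ≤ length E → All ((length E ∸ w) <_) E → Periodic (zigzagAfter w E)
zigzagAfter-periodic w E 1≤w w≤2 w≤E k< = length E , ≤-trans 1≤w w≤E , (begin
  iterate (length E) s123,132 (zigzagAfter w E)
    ≡⟨ iterate-cong s123,132≗stackSort (length E) _ ⟩
  iterate (length E) stackSort (zigzagAfter w E)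
    ≡⟨ iterate-semiconj {Window} stackSort (zigzagAfter w) rotate rotate-window
         (λ (w≤ , k<′) → stackSort-zigzagAfter w _ 1≤w w≤2 w≤ k<′) (length E) (w≤E , k<) ⟩
  zigzagAfter w (iterate (length E) rotate E)
    ≡⟨ cong (zigzagAfter w) (trans (cong (iterate (length E) rotate) (sym (++-identityʳ E))) (iterate-rotate E [])) ⟩
  zigzagAfter w E ∎)
  where
  open ≡-Reasoning
  Window : List ℕ → Set
  Window E′ = w ≤ length E′ × All ((length E′ ∸ w) <_) E′
  rotate-window : ∀ {E′} → Window E′ → Window (rotate E′)
  rotate-window {E′} (w≤ , k<′) rewrite length-rotate E′ = w≤ , rotate-All k<′

-- Two applications per round

module Rounds (n : ℕ) (1≤n : 1 ≤ n) where

  m : ℕ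
  m = (n ∸ 1) / 2

  private
    k*2≡k+k : ∀ k → k * 2 ≡ k + k
    k*2≡k+k = solve-∀
    2*k≡k+k : ∀ k → 2 * k ≡ k + k
    2*k≡k+k = solve-∀
    1+[n∸1]≡n : suc (n ∸ 1) ≡ n
    1+[n∸1]≡n = m+[n∸m]≡n 1≤n

  m+m<n : m + m < n
  m+m<n = subst (m + m <_) 1+[n∸1]≡n (s≤s (subst (_≤ n ∸ 1) (k*2≡k+k m) (m/n*n≤m (n ∸ 1) 2)))

  n≤2+m+m : n ≤ 2 + (m + m)
  n≤2+m+m = subst (_≤ 2 + (m + m)) 1+[n∸1]≡n (s≤s (subst (_≤ 1 + (m + m)) (sym (m≡m%n+[m/n]*n (n ∸ 1) 2))
              (+-mono-≤ (≤-pred (m%n<n (n ∸ 1) 2)) (≤-reflexive (k*2≡k+k m)))))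

  ≤m⇒≤n : ∀ {j} → j ≤ m → j ≤ n
  ≤m⇒≤n j≤m = <⇒≤ (≤-<-trans (≤-trans j≤m (m≤m+n m m)) m+m<n)

  record Enumerates (k : ℕ) (l : List ℕ) : Set where
    field
      unique : Unique l
      above : All (k <_) l
      complete : ∀ j → k < j → j ≤ n → j ∈ l

  open Enumerates

  Enumerates-↭ : ∀ {k l l′} → l ↭ l′ → Enumerates k l → Enumerates k l′
  Enumerates-↭ l↭l′ e = record
    { unique = Unique-↭ l↭l′ (unique e)
    ; above = All-resp-↭ l↭l′ (above e)
    ; complete = λ j k<j j≤n → ∈-resp-↭ l↭l′ (complete e j k<j j≤n)
    }

  Enumerates-∷ : ∀ {k l} → Enumerates k (suc k ∷ l) → Enumerates (suc k) l
  Enumerates-∷ {k} {l} e = record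
    { unique = unique-tail (unique e)
    ; above = All-≤⇒All-< (All.tail (above e)) (Unique[x∷xs]⇒x∉xs (unique e))
    ; complete = λ j k+1<j j≤n → in-tail j k+1<j (complete e j (<-trans (n<1+n k) k+1<j) j≤n)
    }
    where
    unique-tail : ∀ {x} {xs : List ℕ} → Unique (x ∷ xs) → Unique xs
    unique-tail (_ ∷ u) = u
    in-tail : ∀ j → suc k < j → j ∈ suc k ∷ l → j ∈ l
    in-tail j k+1<j (here refl) = contradiction k+1<j (<-irrefl refl)
    in-tail j _ (there j∈l) = j∈l

  -- The state after 2k + p applications of s, for p ∈ {0, 1}.
  record Invariant (p k : ℕ) (α q : List ℕ) : Set where
    field
      length-q : length q ≡ k
      length-α : length α + (k + k) ≡ n
      enumerates : Enumerates k (α ++ q)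
      near-end : ∀ r → 1 ≤ r → r ≤ p + k → k + r ≤ m → k + r ∈ α → AmongLast (r + r) (k + r) α
      near-front : ∀ r → 1 ≤ r → r ≤ p + k → k + r ≤ m → k + r ∈ q → k + r ∈ take (r ∸ p) q

  open Invariant

  module _ {p k α q} (I : Invariant p k α q) where

    bounded : All (length q <_) (α ++ q)
    bounded = subst (λ k → All (k <_) (α ++ q)) (sym (length-q I)) (above (enumerates I))

    unique-α : Unique α
    unique-α = Unique-++⁻ˡ α (unique (enumerates I))

    smaller-near-end : ∀ r → r ≤ p + k → k + suc r ≤ m → ∀ y → y ∈ α → y < k + suc r → AmongLast (r + r) y α
    smaller-near-end r r≤ x≤m y y∈α y<x with split-above k (All.lookup (All-++⁻ˡ α (above (enumerates I))) y∈α)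
    ... | d , refl =
      AmongLast-mono (+-mono-≤ d<r d<r) (near-end I (suc d) (s≤s z≤n) (≤-trans d<r r≤) (≤-trans (<⇒≤ y<x) x≤m) y∈α)
      where
      d<r : suc d ≤ r
      d<r = ≤-pred (+-cancelˡ-< k (suc d) (suc r) y<x)

    tail-step : ∀ r → r ≤ p + k → k + suc r ≤ m → k + suc r ∈ α → AmongLast (2 + (r + r)) (k + suc r) (stackSort α)
    tail-step r r≤ x≤m x∈α = tail-lemma unique-α x∈α (smaller-near-end r r≤ x≤m)

  first-not-small : ∀ {p k h rest q} → Invariant p k (h ∷ rest) q →
    ∀ r → 1 ≤ r → r ≤ p + k → k + r ≤ m → k + r ≢ h
  first-not-small {p} {k} {rest = rest} I r 1≤r r≤ x≤m refl = <⇒≱ m+m<n (begin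
    n                              ≡⟨ length-α I ⟨
    suc (length rest) + (k + k)    ≤⟨ +-monoˡ-≤ (k + k) short ⟩
    (r + r) + (k + k)              ≡⟨ regroup r k ⟩
    (k + r) + (k + r)              ≤⟨ +-mono-≤ x≤m x≤m ⟩
    m + m                          ∎)
    where
    open ≤-Reasoning
    short : length rest < r + r
    short = AmongLast-head (unique-α I) (near-end I r 1≤r r≤ x≤m (here refl))
    regroup : ∀ r k → (r + r) + (k + k) ≡ (k + r) + (k + r)
    regroup = solve-∀

  near-end-first-half : ∀ {k α q P h c} → Invariant 0 k α q → stackSort α ≡ P ++ [ h ] →
    ∀ r → 1 ≤ r → r ≤ suc k → k + r ≤ m → k + r ∈ P ++ [ c ] → AmongLast (r + r) (k + r) (P ++ [ c ])
  near-end-first-half {k} {α} {P = P} {h} {c} I sorted (suc r) _ r≤ x≤m x∈ with ∈-++⁻ P x∈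
  ... | inj₂ (here refl) = AmongLast-last P _
  ... | inj₁ x∈P = subst (λ N → AmongLast N (k + suc r) (P ++ [ c ])) (cong suc (sym (+-suc r r))) (AmongLast-++ʳ [ c ] cut)
    where
    sorted-↭ : P ++ [ h ] ↭ α
    sorted-↭ = subst (_↭ α) sorted (stackSort-↭ α)
    cut : AmongLast (suc (r + r)) (k + suc r) P
    cut = AmongLast-cut P (Unique-↭ (↭-sym sorted-↭) (unique-α I)) x∈P
            (subst (AmongLast _ _) sorted (tail-step I r (≤-pred r≤) x≤m (∈-resp-↭ sorted-↭ (∈-++⁺ˡ x∈P))))

  near-front-first-half : ∀ {k h rest q c q′} → Invariant 0 k (h ∷ rest) q → q ++ [ h ] ≡ c ∷ q′ →
    ∀ r → 1 ≤ r → r ≤ suc k → k + r ≤ m → k + r ∈ q′ → k + r ∈ take (r ∸ 1) q′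
  near-front-first-half {k} {h} {rest} {q} {c} {q′} I q∷ʳh (suc r) _ r≤ x≤m x∈q′ with m≤n⇒m<n∨m≡n (≤-pred r≤)
  ... | inj₂ refl = subst (_ ∈_) (sym (take-all r q′ (≤-reflexive (trans (length-∷ʳ-tail q q∷ʳh) (length-q I))))) x∈q′
  ... | inj₁ r<k = ∈-take-shift q (Unique-++⁻ʳ (h ∷ rest) (unique (enumerates I))) q∷ʳh
                     (first-not-small I (suc r) (s≤s z≤n) r<k x≤m) (near-front I (suc r) (s≤s z≤n) r<k x≤m) x∈q′

  first-half : ∀ {k α q} → k ≤ m → Invariant 0 k α q →
    ∃₂ λ α′ q′ → stackSort (α ++ zigzag q) ≡ α′ ++ zigzag q′ × Invariant 1 k α′ q′
  first-half {k} {[]} k≤m I = contradiction (≤-<-trans (+-mono-≤ k≤m k≤m) m+m<n) (<-irrefl (length-α I))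
  first-half {k} {h ∷ rest} {q} k≤m I with stackSort-zigzag h rest q (bounded I) | ∷ʳ-view q h
  ... | P , sorted , sorted-with-zigzag | c , q′ , q∷ʳh = P ++ [ c ] , q′ , output , record
    { length-q = trans (length-∷ʳ-tail q q∷ʳh) (length-q I)
    ; length-α = trans (cong (_+ (k + k)) length-α′) (length-α I)
    ; enumerates = Enumerates-↭ perm (enumerates I)
    ; near-end = near-end-first-half I sorted
    ; near-front = near-front-first-half I q∷ʳh
    }
    where
    α = h ∷ rest
    output : stackSort (α ++ zigzag q) ≡ (P ++ [ c ]) ++ zigzag q′
    output = trans sorted-with-zigzag (trans (cong (λ l → P ++ zigzagTail l) q∷ʳh) (sym (++-assoc P [ c ] (zigzag q′))))
    length-α′ : length (P ++ [ c ]) ≡ length α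
    length-α′ = trans (length-∷ʳ P c) (trans (sym (length-∷ʳ P h)) (trans (cong length (sym sorted)) (length-stackSort α)))
    perm : α ++ q ↭ (P ++ [ c ]) ++ q′
    perm = begin
      α ++ q                ↭⟨ ++⁺ʳ q (stackSort-↭ α) ⟨
      stackSort α ++ q      ≡⟨ trans (cong (_++ q) sorted) (++-assoc P [ h ] q) ⟩
      P ++ [ h ] ++ q       ↭⟨ ++⁺ˡ P (++-comm [ h ] q) ⟩
      P ++ q ++ [ h ]       ≡⟨ trans (cong (P ++_) q∷ʳh) (sym (++-assoc P [ c ] q′)) ⟩
      (P ++ [ c ]) ++ q′    ∎
      where open PermutationReasoning

  private
    k+1≡ : ∀ k → k + 1 ≡ suc k
    k+1≡ k = +-comm k 1

  next-in-α : ∀ {k α q} → suc k ≤ m → Invariant 1 k α q → suc k ∈ α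
  next-in-α {k} {α} {q} k+1≤m I with ∈-++⁻ α (complete (enumerates I) (suc k) ≤-refl (≤m⇒≤n k+1≤m))
  ... | inj₁ k+1∈α = k+1∈α
  ... | inj₂ k+1∈q with near-front I 1 ≤-refl (s≤s z≤n) (subst (_≤ m) (sym (k+1≡ k)) k+1≤m) (subst (_∈ q) (sym (k+1≡ k)) k+1∈q)
  ... | ()

  near-end-second-half : ∀ {k α q C h} → Invariant 1 k α q → stackSort α ≡ C ++ suc k ∷ h ∷ [] →
    ∀ r → 1 ≤ r → r ≤ suc k → suc k + r ≤ m → suc k + r ∈ C → AmongLast (r + r) (suc k + r) C
  near-end-second-half {k} {α} {C = C} {h} I sorted r _ r≤ x≤m x∈C = AmongLast-cut C unique-sorted x∈C near
    where
    sorted-↭ : C ++ suc k ∷ h ∷ [] ↭ α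
    sorted-↭ = subst (_↭ α) sorted (stackSort-↭ α)
    unique-sorted : Unique (C ++ suc k ∷ h ∷ [])
    unique-sorted = Unique-↭ (↭-sym sorted-↭) (unique-α I)
    x≡ : suc k + r ≡ k + suc r
    x≡ = sym (+-suc k r)
    near : AmongLast (2 + (r + r)) (suc k + r) (C ++ suc k ∷ h ∷ [])
    near = subst₂ (AmongLast _) (sym x≡) sorted
             (tail-step I r r≤ (subst (_≤ m) x≡ x≤m) (subst (_∈ α) x≡ (∈-resp-↭ sorted-↭ (∈-++⁺ˡ x∈C))))

  near-front-second-half : ∀ {k h rest q} → Invariant 1 k (h ∷ rest) q →
    ∀ r → 1 ≤ r → r ≤ suc k → suc k + r ≤ m → suc k + r ∈ q ++ [ h ] → suc k + r ∈ take r (q ++ [ h ])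
  near-front-second-half {k} {h} {rest} {q} I r _ r≤ x≤m x∈ with m≤n⇒m<n∨m≡n r≤
  ... | inj₂ refl =
    subst (_ ∈_) (sym (take-all (suc k) (q ++ [ h ]) (≤-reflexive (trans (length-∷ʳ q h) (cong suc (length-q I)))))) x∈
  ... | inj₁ r<k+1 with ∈-++⁻ q x∈
  ...   | inj₁ x∈q =
    ∈-take-++ r q (subst (_∈ take r q) (sym x≡) (near-front I (suc r) (s≤s z≤n) r<k+1 x≤m′ (subst (_∈ q) x≡ x∈q)))
    where
    x≡ : suc k + r ≡ k + suc r
    x≡ = sym (+-suc k r)
    x≤m′ : k + suc r ≤ m
    x≤m′ = subst (_≤ m) x≡ x≤m
  ...   | inj₂ (here x≡h) =
    ⊥-elim (first-not-small I (suc r) (s≤s z≤n) r<k+1 (subst (_≤ m) (sym (+-suc k r)) x≤m) (trans (+-suc k r) x≡h))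

  next-second-last : ∀ {k h rest q P} → suc k ≤ m → Invariant 1 k (h ∷ rest) q → suc k ∈ h ∷ rest →
    stackSort (h ∷ rest) ≡ P ++ [ h ] → ∃ λ C → P ≡ C ++ [ suc k ]
  next-second-last {k} {h} {rest} {P = P} k+1≤m I k+1∈α sorted =
    AmongLast-2⇒second-to-last P (subst (AmongLast 2 (suc k)) sorted second-last) k+1≢h
    where
    k+1≤m′ : k + 1 ≤ m
    k+1≤m′ = subst (_≤ m) (sym (k+1≡ k)) k+1≤m
    second-last : AmongLast 2 (suc k) (stackSort (h ∷ rest))
    second-last = subst (λ x → AmongLast 2 x (stackSort (h ∷ rest))) (k+1≡ k)
                    (tail-step I 0 z≤n k+1≤m′ (subst (_∈ h ∷ rest) (sym (k+1≡ k)) k+1∈α))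
    k+1≢h : suc k ≢ h
    k+1≢h = first-not-small I 1 ≤-refl (s≤s z≤n) k+1≤m′ ∘ trans (k+1≡ k)

  second-half : ∀ {k α q} → suc k ≤ m → Invariant 1 k α q →
    ∃₂ λ α′ q′ → stackSort (α ++ zigzag q) ≡ α′ ++ zigzag q′ × Invariant 0 (suc k) α′ q′
  second-half {k} {α} k+1≤m I with next-in-α k+1≤m I
  second-half {k} {h ∷ rest} {q} k+1≤m I | k+1∈α with stackSort-zigzag h rest q (bounded I)
  ... | P , sorted , sorted-with-zigzag with next-second-last k+1≤m I k+1∈α sorted
  ...   | C , refl = C , q ++ [ h ] , output , record
    { length-q = trans (length-∷ʳ q h) (cong suc (length-q I))
    ; length-α = trans (regroup (length C) k) (trans (cong (_+ (k + k)) length-C) (length-α I))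
    ; enumerates = Enumerates-∷ (Enumerates-↭ perm (enumerates I))
    ; near-end = near-end-second-half I sorted′
    ; near-front = near-front-second-half I
    }
    where
    α = h ∷ rest
    sorted′ : stackSort α ≡ C ++ suc k ∷ h ∷ []
    sorted′ = trans sorted (++-assoc C [ suc k ] [ h ])
    output : stackSort (α ++ zigzag q) ≡ C ++ zigzag (q ++ [ h ])
    output = trans sorted-with-zigzag (trans (++-assoc C [ suc k ] _)
               (cong (C ++_) (sym (trans (zigzag-∷ʳ q h) (cong (λ l → suc l ∷ zigzagTail (q ++ [ h ])) (length-q I))))))
    length-C : length C + 2 ≡ length α
    length-C = trans (sym (length-++ C)) (trans (cong length (sym sorted′)) (length-stackSort α))
    regroup : ∀ c k → c + (suc k + suc k) ≡ (c + 2) + (k + k)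
    regroup = solve-∀
    perm : α ++ q ↭ suc k ∷ C ++ q ++ [ h ]
    perm = begin
      α ++ q                      ↭⟨ ++⁺ʳ q (stackSort-↭ α) ⟨
      stackSort α ++ q            ≡⟨ trans (cong (_++ q) sorted′) (++-assoc C _ q) ⟩
      C ++ suc k ∷ h ∷ q          ↭⟨ shift (suc k) C (h ∷ q) ⟩
      suc k ∷ C ++ h ∷ q          ↭⟨ prep (suc k) (++⁺ˡ C (++-comm [ h ] q)) ⟩
      suc k ∷ C ++ q ++ [ h ]     ∎
      where open PermutationReasoning

  enumerates-oneToN : Enumerates 0 (oneToN n)
  enumerates-oneToN = record
    { unique = map⁺ suc-injective (upTo⁺ n)
    ; above = All.tabulate λ y∈ → case ∈-map⁻ suc y∈ of λ { (_ , _ , refl) → s≤s z≤n }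
    ; complete = λ { (suc i) _ i<n → ∈-map⁺ suc (∈-upTo⁺ i<n) }
    }

  initial : ∀ {π} → InS n π → Invariant 0 0 π []
  initial {π} π↭ = record
    { length-q = refl
    ; length-α = trans (+-identityʳ (length π)) (trans (↭-length π↭) (trans (length-map suc (upTo n)) (length-upTo n)))
    ; enumerates = subst (Enumerates 0) (sym (++-identityʳ π)) (Enumerates-↭ (↭-sym π↭) enumerates-oneToN)
    ; near-end = λ r 1≤r r≤0 → contradiction r≤0 (<⇒≱ 1≤r)
    ; near-front = λ r 1≤r r≤0 → contradiction r≤0 (<⇒≱ 1≤r)
    }

  rounds : ∀ {π} → InS n π → ∀ k → k ≤ m →
    ∃₂ λ α q → iterate (k + k) stackSort π ≡ α ++ zigzag q × Invariant 0 k α q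
  rounds {π} π∈Sₙ zero _ = π , [] , sym (++-identityʳ π) , initial π∈Sₙ
  rounds {π} π∈Sₙ (suc k) k+1≤m with rounds π∈Sₙ k (<⇒≤ k+1≤m)
  ... | α , q , reached , I with first-half (<⇒≤ k+1≤m) I
  ...   | α₁ , q₁ , step₁ , I₁ with second-half k+1≤m I₁
  ...     | α₂ , q₂ , step₂ , I₂ = α₂ , q₂ , (begin
    iterate (suc k + suc k) stackSort π               ≡⟨ cong (λ j → iterate (suc j) stackSort π) (+-suc k k) ⟩
    stackSort (stackSort (iterate (k + k) stackSort π)) ≡⟨ cong (stackSort ∘ stackSort) reached ⟩
    stackSort (stackSort (α ++ zigzag q))             ≡⟨ cong stackSort step₁ ⟩
    stackSort (α₁ ++ zigzag q₁)                       ≡⟨ step₂ ⟩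
    α₂ ++ zigzag q₂                                   ∎) , I₂
    where open ≡-Reasoning

  final-periodic : ∀ {α q} → Invariant 0 m α q → Periodic (α ++ zigzag q)
  final-periodic {α} {q} I = subst Periodic (zigzagAfter-++ α q)
    (zigzagAfter-periodic (length α) (α ++ q) 1≤length length≤2 (subst (length α ≤_) (sym (length-++ α)) (m≤m+n _ _)) bounds)
    where
    1≤length : 1 ≤ length α
    1≤length = +-cancelʳ-< (m + m) 0 (length α) (subst (m + m <_) (sym (length-α I)) m+m<n)
    length≤2 : length α ≤ 2
    length≤2 = +-cancelʳ-≤ (m + m) (length α) 2 (subst (_≤ 2 + (m + m)) (sym (length-α I)) n≤2+m+m)
    bounds : All ((length (α ++ q) ∸ length α) <_) (α ++ q)
    bounds = subst (λ l → All (l <_) (α ++ q))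
               (sym (trans (cong (_∸ length α) (length-++ α)) (m+n∸m≡n (length α) (length q)))) (bounded I)

  periodic-after-rounds : ∀ {π} → InS n π → Periodic (iterate (2 * m) s123,132 π)
  periodic-after-rounds {π} π∈Sₙ with rounds π∈Sₙ m ≤-refl
  ... | α , q , reached , I = subst Periodic (sym after-rounds) (final-periodic I)
    where
    after-rounds : iterate (2 * m) s123,132 π ≡ α ++ zigzag q
    after-rounds = trans (iterate-cong s123,132≗stackSort (2 * m) π) (trans (cong (λ j → iterate j stackSort π) (2*k≡k+k m)) reached)

corollary3p11 : ∀ (n : ℕ) → 1 ≤ n → OrdSnAtMost n (2 * ((n ∸ 1) / 2))
corollary3p11 n 1≤n = 2 * ((n ∸ 1) / 2) , ≤-refl , λ π π∈Sₙ → Rounds.periodic-after-rounds n 1≤n π∈Sₙ
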